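{- Let $\Gamma=(V,E)$ be a finite point-transitive reflexive relation in which every vertex has degree $r$ (i.e. $|\Gamma(x)|=r$ for all $x\in V$), let $v\in V$, and let $j\ge 1$ be an integer. If $\Gamma^j(v)\cap\Gamma^{ - }(v)=\{v\}$, then $$|\Gamma^{j}(v)|\ge 1+(r-1)j.$$
   Context: A relation is a pair $\Gamma=(V,E)$ with $E\subset V\times V$; it is reflexive if $(x,x)\in E$ for all $x\in V$. For $a\in V$, $\Gamma(a)=\{y:(a,y)\in E\}$. The reverse relation is $\Gamma^-=(V,E^-)$ with $E^-=\{(x,y):(y,x)\in E\}$, so $\Gamma^-(v)=\{x:(x,v)\in E\}$. $\Gamma^k$ denotes the $k$-fold composition of $\Gamma$ with itself ($\Gamma^0$ is the identity relation), so $\Gamma^k(a)$ is the set of vertices reachable from $a$ by a walk of exactly $k$ arcs. An automorphism of $\Gamma$ is a bijection $f:V\to V$ with $(x,y)\in E\iff(f(x),f(y))\in E$; $\Gamma$ is point-transitive if the automorphism group acts transitively on $V$. -}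

module Defs where

open import Data.Nat using (ℕ; zero; suc)
open import Data.Bool using (Bool; true; false; _∧_)
open import Data.Fin using (Fin)
open import Data.Fin.Subset using (Subset; ⁅_⁆; ∣_∣)
open import Data.Vec using (tabulate; lookup)
open import Data.List using (allFin)
open import Data.Bool.ListAction using (any)
open import Data.Product using (Σ; ∃; _×_)
open import Function.Bundles using (Bijection; _⤖_)
open import Relation.Binary.PropositionalEquality using (_≡_)

Relation : ℕ → Set
Relation n = Fin n → Fin n → Bool

Reflexive : ∀ {n} → Relation n → Set
Reflexive {n} Γ = (x : Fin n) → Γ x x ≡ true

out : ∀ {n} → Relation n → Fin n → Subset n
out Γ a = tabulate (Γ a)

inn : ∀ {n} → Relation n → Fin n → Subset n
inn Γ v = tabulate (λ x → Γ x v)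

power : ∀ {n} → Relation n → ℕ → Fin n → Subset n
power Γ zero    a = ⁅ a ⁆
power {n} Γ (suc k) a =
  tabulate (λ z → any (λ y → lookup (power Γ k a) y ∧ Γ y z) (allFin n))

IsAutomorphism : ∀ {n} → Relation n → (Fin n ⤖ Fin n) → Set
IsAutomorphism {n} Γ f =
  (x y : Fin n) → Γ (Bijection.to f x) (Bijection.to f y) ≡ Γ x y

PointTransitive : ∀ {n} → Relation n → Set
PointTransitive {n} Γ =
  (x y : Fin n) → Σ (Fin n ⤖ Fin n) λ f → IsAutomorphism Γ f × (Bijection.to f x ≡ y)

Regular : ∀ {n} → Relation n → ℕ → Set
Regular {n} Γ r = (x : Fin n) → ∣ out Γ x ∣ ≡ r

{-# OPTIONS --safe #-}
module Submission where

-- Say X is anchored at u when X ∩ Γ⁻(u) = {u}, and put ∂X = Γ(X) ∖ X.  Let μ be the least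
-- |∂X| over anchored sets, and call an anchored set with |∂X| = μ of least size an atom.
-- For atoms A at a and B at b with b ∈ A we get a ∈ Γ(B): otherwise A ∪ B is anchored at a,
-- so submodularity of |∂| gives |∂(A ∩ B)| ≤ μ; minimality of |B| then forces B ⊆ A and A = B,
-- whence a ∈ B ⊆ Γ(B) after all.
-- Transitivity moves one atom to every vertex, and double counting the non-loop arcs against
-- boundary incidences yields r − 1 ≤ μ.  Thus |Γ(X)| ≥ |X| + r − 1 for anchored X; the sets
-- Γᵏ(v) with k < j lie in Γʲ(v), so they are anchored at v and each step adds r − 1 vertices.

open import Defs
open import Data.Nat using (ℕ; zero; suc; _+_; _*_; _∸_; _≤_; _≥_; _<_; _≤′_; ≤′-refl; ≤′-step; z≤n; _<?_; _≤?_)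
open import Data.Fin using (Fin; zero; suc)
open import Data.Fin.Subset using (Subset; inside; outside; _∈_; _∉_; _⊆_; _∩_; _∪_; _─_; ⁅_⁆; ∣_∣)
open import Relation.Binary.PropositionalEquality using (_≡_; _≢_; refl; sym; trans; cong; cong₂; subst; module ≡-Reasoning)

open import Algebra.Properties.CommutativeSemigroup using (interchange)
open import Data.Bool using (Bool; true; T; _∧_; if_then_else_)
open import Data.Bool.Properties using (T-≡; T-∧) renaming (_≟_ to _≟ᵇ_)
open import Data.Bool.ListAction using (any)
open import Data.Fin.Properties using (any?; all?; nonZeroIndex) renaming (_≟_ to _≟ᶠ_)
open import Data.Fin.Subset.Properties
  using (_∈?_; anySubset?; drop-∷-⊆; p⊂q⇒∣p∣<∣q∣; x∈p∩q⁺; x∈p∩q⁻; x∈p∪q⁺; x∈p∪q⁻; p∩q⊆p; p∩q⊆q;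
         x∈p∧x∉q⇒x∈p─q; p⊆q⇒∣p∣≤∣q∣; ⊆-antisym; x∈⁅x⁆; x∈⁅y⁆⇒x≡y; ∣⁅x⁆∣≡1)
open import Data.List using (allFin)
open import Data.List.Membership.Propositional using (find; lose)
open import Data.List.Membership.Propositional.Properties using (∈-allFin)
open import Data.List.Relation.Unary.Any.Properties using (any⁺; any⁻)
open import Data.Nat.Induction using (<-wellFounded)
open import Data.Nat.Properties
open import Data.Product using (∃; _×_; _,_; proj₁; proj₂)
open import Data.Sum as Sum using (_⊎_; inj₁; inj₂; [_,_]′)
open import Data.Vec using ([]; _∷_; here; tabulate; lookup)
open import Data.Vec.Properties using (lookup∘tabulate; []=⇒lookup; lookup⇒[]=)
open import Function using (_∘_; id)
open import Function.Bundles using (_⇔_; mk⇔; Equivalence; Bijection; _⤖_)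
open import Function.Properties.Bijection using (⤖⇒↔)
open import Induction.WellFounded using (Acc; acc)
open import Relation.Nullary using (Dec; yes; no; does; ¬_; ¬?; _×-dec_; _⊎-dec_; _→-dec_; contradiction)
import Relation.Nullary.Decidable as Dec
open import Relation.Unary using (Pred; Decidable)
open import Algebra.Properties.CommutativeMonoid.Sum +-0-commutativeMonoid
  using (sum-syntax; ∑-comm; ∑-distrib-+; sum-cong-≗; sum-permute)

open Equivalence using (to; from)

𝟙 : ∀ {p} {P : Set p} → Dec P → ℕ
𝟙 P? = if does P? then 1 else 0

𝟙-yes : ∀ {p} {P : Set p} → P → (P? : Dec P) → 𝟙 P? ≡ 1
𝟙-yes _ (yes _) = refl
𝟙-yes p (no ¬p) = contradiction p ¬p

𝟙-cong : ∀ {p q} {P : Set p} {Q : Set q} → P ⇔ Q → (P? : Dec P) (Q? : Dec Q) → 𝟙 P? ≡ 𝟙 Q?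
𝟙-cong _   (yes _) (yes _) = refl
𝟙-cong _   (no _)  (no _)  = refl
𝟙-cong P⇔Q (yes p) (no ¬q) = contradiction (to P⇔Q p) ¬q
𝟙-cong P⇔Q (no ¬p) (yes q) = contradiction (from P⇔Q q) ¬p

module _ {p q r} {P : Set p} {Q : Set q} {R : Set r} where

  𝟙-cover : (P → Q ⊎ R) → (P? : Dec P) (Q? : Dec Q) (R? : Dec R) → 𝟙 P? ≤ 𝟙 Q? + 𝟙 R?
  𝟙-cover _ (no _) _ _ = z≤n
  𝟙-cover P⇒Q⊎R (yes p) Q? R? with P⇒Q⊎R p
  ... | inj₁ q = subst (_≤ 𝟙 Q? + 𝟙 R?) (𝟙-yes q Q?) (m≤m+n (𝟙 Q?) (𝟙 R?))
  ... | inj₂ r = subst (_≤ 𝟙 Q? + 𝟙 R?) (𝟙-yes r R?) (m≤n+m (𝟙 R?) (𝟙 Q?))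

  𝟙-disjoint : (P → R) → (Q → R) → (P → ¬ Q) →
               (P? : Dec P) (Q? : Dec Q) (R? : Dec R) → 𝟙 P? + 𝟙 Q? ≤ 𝟙 R?
  𝟙-disjoint _   _   _    (no _)  (no _)  _  = z≤n
  𝟙-disjoint P⇒R _   _    (yes p) (no _)  R? = ≤-reflexive (sym (𝟙-yes (P⇒R p) R?))
  𝟙-disjoint _   Q⇒R _    (no _)  (yes q) R? = ≤-reflexive (sym (𝟙-yes (Q⇒R q) R?))
  𝟙-disjoint _   _   P⇒¬Q (yes p) (yes q) _  = contradiction q (P⇒¬Q p)

∑-mono-≤ : ∀ {n} {f g : Fin n → ℕ} → (∀ i → f i ≤ g i) → ∑[ i < n ] f i ≤ ∑[ i < n ] g i
∑-mono-≤ {zero}  _   = z≤n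
∑-mono-≤ {suc n} f≤g = +-mono-≤ (f≤g zero) (∑-mono-≤ (f≤g ∘ suc))

∑-const : ∀ n c → ∑[ i < n ] c ≡ n * c
∑-const zero    c = refl
∑-const (suc n) c = cong (c +_) (∑-const n c)

∣p∣≡∑𝟙∈ : ∀ {n} (p : Subset n) → ∣ p ∣ ≡ ∑[ i < n ] 𝟙 (i ∈? p)
∣p∣≡∑𝟙∈ []            = refl
∣p∣≡∑𝟙∈ (inside  ∷ p) = cong suc (∣p∣≡∑𝟙∈ p)
∣p∣≡∑𝟙∈ (outside ∷ p) = ∣p∣≡∑𝟙∈ p

∣p∩q∣+∣p∪q∣≡∣p∣+∣q∣ : ∀ {n} (p q : Subset n) → ∣ p ∩ q ∣ + ∣ p ∪ q ∣ ≡ ∣ p ∣ + ∣ q ∣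
∣p∩q∣+∣p∪q∣≡∣p∣+∣q∣ [] [] = refl
∣p∩q∣+∣p∪q∣≡∣p∣+∣q∣ (inside ∷ p) (inside ∷ q) =
  cong suc (trans (+-suc _ _) (trans (cong suc (∣p∩q∣+∣p∪q∣≡∣p∣+∣q∣ p q)) (sym (+-suc _ _))))
∣p∩q∣+∣p∪q∣≡∣p∣+∣q∣ (inside ∷ p) (outside ∷ q) =
  trans (+-suc _ _) (cong suc (∣p∩q∣+∣p∪q∣≡∣p∣+∣q∣ p q))
∣p∩q∣+∣p∪q∣≡∣p∣+∣q∣ (outside ∷ p) (inside ∷ q) =
  trans (+-suc _ _) (trans (cong suc (∣p∩q∣+∣p∪q∣≡∣p∣+∣q∣ p q)) (sym (+-suc _ _)))
∣p∩q∣+∣p∪q∣≡∣p∣+∣q∣ (outside ∷ p) (outside ∷ q) = ∣p∩q∣+∣p∪q∣≡∣p∣+∣q∣ p q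

∣p─q∣+∣q∣≡∣p∣ : ∀ {n} {p q : Subset n} → q ⊆ p → ∣ p ─ q ∣ + ∣ q ∣ ≡ ∣ p ∣
∣p─q∣+∣q∣≡∣p∣ {p = []}          {[]}          _   = refl
∣p─q∣+∣q∣≡∣p∣ {p = inside ∷ p}  {inside ∷ q}  q⊆p = trans (+-suc _ _) (cong suc (∣p─q∣+∣q∣≡∣p∣ (drop-∷-⊆ q⊆p)))
∣p─q∣+∣q∣≡∣p∣ {p = inside ∷ p}  {outside ∷ q} q⊆p = cong suc (∣p─q∣+∣q∣≡∣p∣ (drop-∷-⊆ q⊆p))
∣p─q∣+∣q∣≡∣p∣ {p = outside ∷ p} {inside ∷ q}  q⊆p = contradiction (q⊆p here) λ ()
∣p─q∣+∣q∣≡∣p∣ {p = outside ∷ p} {outside ∷ q} q⊆p = ∣p─q∣+∣q∣≡∣p∣ (drop-∷-⊆ q⊆p)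

p⊆q⇒∣q∣≤∣p∣⇒q⊆p : ∀ {n} {p q : Subset n} → p ⊆ q → ∣ q ∣ ≤ ∣ p ∣ → q ⊆ p
p⊆q⇒∣q∣≤∣p∣⇒q⊆p {p = p} p⊆q ∣q∣≤∣p∣ {x} x∈q with x ∈? p
... | yes x∈p = x∈p
... | no  x∉p = contradiction (p⊂q⇒∣p∣<∣q∣ (p⊆q , x , x∈q , x∉p)) (≤⇒≯ ∣q∣≤∣p∣)

∈tabulate⁺ : ∀ {n} {f : Fin n → Bool} {x} → f x ≡ true → x ∈ tabulate f
∈tabulate⁺ {f = f} {x} fx = lookup⇒[]= x (tabulate f) (trans (lookup∘tabulate f x) fx)

∈tabulate⁻ : ∀ {n} {f : Fin n → Bool} {x} → x ∈ tabulate f → f x ≡ true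
∈tabulate⁻ {f = f} {x} x∈ = trans (sym (lookup∘tabulate f x)) ([]=⇒lookup x∈)

preimage : ∀ {m n} → (Fin m → Fin n) → Subset n → Subset m
preimage f p = tabulate (λ x → lookup p (f x))

module _ {m n} {f : Fin m → Fin n} {p : Subset n} {x : Fin m} where

  ∈preimage⁺ : f x ∈ p → x ∈ preimage f p
  ∈preimage⁺ = ∈tabulate⁺ ∘ []=⇒lookup

  ∈preimage⁻ : x ∈ preimage f p → f x ∈ p
  ∈preimage⁻ = lookup⇒[]= (f x) p ∘ ∈tabulate⁻

∣preimage∣ : ∀ {n} (σ : Fin n ⤖ Fin n) (p : Subset n) → ∣ preimage (Bijection.to σ) p ∣ ≡ ∣ p ∣
∣preimage∣ {n} σ p = begin
  ∣ preimage σ→ p ∣                 ≡⟨ ∣p∣≡∑𝟙∈ (preimage σ→ p) ⟩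
  ∑[ i < n ] 𝟙 (i ∈? preimage σ→ p) ≡⟨ sum-cong-≗ 𝟙-pointwise ⟩
  ∑[ i < n ] 𝟙 (σ→ i ∈? p)          ≡⟨ sum-permute (λ i → 𝟙 (i ∈? p)) (⤖⇒↔ σ) ⟨
  ∑[ i < n ] 𝟙 (i ∈? p)             ≡⟨ ∣p∣≡∑𝟙∈ p ⟨
  ∣ p ∣                              ∎
  where
  open ≡-Reasoning
  σ→ : Fin n → Fin n
  σ→ = Bijection.to σ
  𝟙-pointwise : ∀ i → 𝟙 (i ∈? preimage σ→ p) ≡ 𝟙 (σ→ i ∈? p)
  𝟙-pointwise i = 𝟙-cong (mk⇔ (∈preimage⁻ {f = σ→} {p}) ∈preimage⁺) (i ∈? preimage σ→ p) (σ→ i ∈? p)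

module _ {n ℓ} {P : Pred (Subset n) ℓ} (P? : Decidable P) (f : Subset n → ℕ) where

  ∃-minimal : ∀ {X} → P X → ∃ λ Y → P Y × (∀ {Z} → P Z → f Y ≤ f Z)
  ∃-minimal {X} PX = descend X PX (<-wellFounded (f X))
    where
    descend : ∀ X → P X → Acc _<_ (f X) → ∃ λ Y → P Y × (∀ {Z} → P Z → f Y ≤ f Z)
    descend X PX (acc smaller) with anySubset? (λ Y → P? Y ×-dec f Y <? f X)
    ... | yes (Y , PY , fY<fX) = descend Y PY (smaller fY<fX)
    ... | no  ∄smaller         = X , PX , λ PZ → ≮⇒≥ (λ fZ<fX → ∄smaller (_ , PZ , fZ<fX))

module _ {n : ℕ} (Γ : Relation n) where

  -- Γ(X), spelled exactly as in power so that power Γ (suc k) v is N⁺ (power Γ k v) by definition.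
  N⁺ : Subset n → Subset n
  N⁺ X = tabulate (λ z → any (λ y → lookup X y ∧ Γ y z) (allFin n))

  ∂ : Subset n → Subset n
  ∂ X = N⁺ X ─ X

  module _ {X : Subset n} where

    ∈N⁺⁺ : ∀ {x z} → x ∈ X → Γ x z ≡ true → z ∈ N⁺ X
    ∈N⁺⁺ {x} x∈X x→z = ∈tabulate⁺ (to T-≡ (any⁺ _ (lose (∈-allFin x) (from T-∧ (T[X[x]] , from T-≡ x→z)))))
      where
      T[X[x]] : T (lookup X x)
      T[X[x]] = from T-≡ ([]=⇒lookup x∈X)

    ∈N⁺⁻ : ∀ {z} → z ∈ N⁺ X → ∃ λ x → x ∈ X × Γ x z ≡ true
    ∈N⁺⁻ z∈N⁺X with find (any⁻ _ (allFin n) (from T-≡ (∈tabulate⁻ z∈N⁺X)))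
    ... | x , _ , T[X[x]∧Γxz] with to T-∧ T[X[x]∧Γxz]
    ...   | T[X[x]] , T[Γxz] = x , lookup⇒[]= x X (to T-≡ T[X[x]]) , to T-≡ T[Γxz]

  p⊆N⁺p : Reflexive Γ → ∀ {p} → p ⊆ N⁺ p
  p⊆N⁺p Γ-refl {x = x} x∈p = ∈N⁺⁺ x∈p (Γ-refl x)

  N⁺-mono : ∀ {p q} → p ⊆ q → N⁺ p ⊆ N⁺ q
  N⁺-mono p⊆q z∈N⁺p with ∈N⁺⁻ z∈N⁺p
  ... | x , x∈p , x→z = ∈N⁺⁺ (p⊆q x∈p) x→z

  N⁺-∪ : ∀ p q → N⁺ (p ∪ q) ⊆ N⁺ p ∪ N⁺ q
  N⁺-∪ p q z∈ with ∈N⁺⁻ z∈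
  ... | x , x∈p∪q , x→z = x∈p∪q⁺ (Sum.map (λ x∈p → ∈N⁺⁺ x∈p x→z) (λ x∈q → ∈N⁺⁺ x∈q x→z) (x∈p∪q⁻ p q x∈p∪q))

  module _ (Γ-refl : Reflexive Γ) where

    ∣∂p∣+∣p∣≡∣N⁺p∣ : ∀ p → ∣ ∂ p ∣ + ∣ p ∣ ≡ ∣ N⁺ p ∣
    ∣∂p∣+∣p∣≡∣N⁺p∣ p = ∣p─q∣+∣q∣≡∣p∣ (p⊆N⁺p Γ-refl)

    ∂-submodular : ∀ p q → ∣ ∂ (p ∩ q) ∣ + ∣ ∂ (p ∪ q) ∣ ≤ ∣ ∂ p ∣ + ∣ ∂ q ∣
    ∂-submodular p q = +-cancelʳ-≤ (∣ p ∩ q ∣ + ∣ p ∪ q ∣) _ _ (begin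
      (∣ ∂ (p ∩ q) ∣ + ∣ ∂ (p ∪ q) ∣) + (∣ p ∩ q ∣ + ∣ p ∪ q ∣)
        ≡⟨ +-interchange ∣ ∂ (p ∩ q) ∣ _ _ _ ⟩
      (∣ ∂ (p ∩ q) ∣ + ∣ p ∩ q ∣) + (∣ ∂ (p ∪ q) ∣ + ∣ p ∪ q ∣)
        ≡⟨ cong₂ _+_ (∣∂p∣+∣p∣≡∣N⁺p∣ (p ∩ q)) (∣∂p∣+∣p∣≡∣N⁺p∣ (p ∪ q)) ⟩
      ∣ N⁺ (p ∩ q) ∣ + ∣ N⁺ (p ∪ q) ∣
        ≤⟨ +-mono-≤ (p⊆q⇒∣p∣≤∣q∣ N⁺-∩) (p⊆q⇒∣p∣≤∣q∣ (N⁺-∪ p q)) ⟩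
      ∣ N⁺ p ∩ N⁺ q ∣ + ∣ N⁺ p ∪ N⁺ q ∣
        ≡⟨ ∣p∩q∣+∣p∪q∣≡∣p∣+∣q∣ (N⁺ p) (N⁺ q) ⟩
      ∣ N⁺ p ∣ + ∣ N⁺ q ∣
        ≡⟨ cong₂ _+_ (∣∂p∣+∣p∣≡∣N⁺p∣ p) (∣∂p∣+∣p∣≡∣N⁺p∣ q) ⟨
      (∣ ∂ p ∣ + ∣ p ∣) + (∣ ∂ q ∣ + ∣ q ∣)
        ≡⟨ +-interchange ∣ ∂ p ∣ ∣ p ∣ _ _ ⟩
      (∣ ∂ p ∣ + ∣ ∂ q ∣) + (∣ p ∣ + ∣ q ∣)
        ≡⟨ cong (∣ ∂ p ∣ + ∣ ∂ q ∣ +_) (∣p∩q∣+∣p∪q∣≡∣p∣+∣q∣ p q) ⟨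
      (∣ ∂ p ∣ + ∣ ∂ q ∣) + (∣ p ∩ q ∣ + ∣ p ∪ q ∣) ∎)
      where
      open ≤-Reasoning
      +-interchange : ∀ a b c d → (a + b) + (c + d) ≡ (a + c) + (b + d)
      +-interchange = interchange +-commutativeSemigroup
      N⁺-∩ : N⁺ (p ∩ q) ⊆ N⁺ p ∩ N⁺ q
      N⁺-∩ z∈ = x∈p∩q⁺ (N⁺-mono (p∩q⊆p p q) z∈ , N⁺-mono (p∩q⊆q p q) z∈)

  module _ {σ : Fin n ⤖ Fin n} (σ-aut : IsAutomorphism Γ σ) where

    private
      σ→ : Fin n → Fin n
      σ→ = Bijection.to σ

    N⁺-preimage : ∀ X → N⁺ (preimage σ→ X) ≡ preimage σ→ (N⁺ X)
    N⁺-preimage X = ⊆-antisym forward backward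
      where
      forward : N⁺ (preimage σ→ X) ⊆ preimage σ→ (N⁺ X)
      forward z∈ with ∈N⁺⁻ z∈
      ... | y , y∈ , y→z = ∈preimage⁺ (∈N⁺⁺ (∈preimage⁻ {f = σ→} {X} y∈) (trans (σ-aut y _) y→z))
      backward : preimage σ→ (N⁺ X) ⊆ N⁺ (preimage σ→ X)
      backward {z} σz∈ with ∈N⁺⁻ (∈preimage⁻ {f = σ→} {N⁺ X} σz∈)
      ... | x , x∈X , x→σz with Bijection.strictlySurjective σ x
      ...   | y , refl = ∈N⁺⁺ (∈preimage⁺ {f = σ→} {X} x∈X) (trans (sym (σ-aut y z)) x→σz)

    ∣∂preimage∣ : Reflexive Γ → ∀ X → ∣ ∂ (preimage σ→ X) ∣ ≡ ∣ ∂ X ∣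
    ∣∂preimage∣ Γ-refl X = +-cancelʳ-≡ ∣ X ∣ _ _ (begin
      ∣ ∂ (preimage σ→ X) ∣ + ∣ X ∣                 ≡⟨ cong (∣ ∂ (preimage σ→ X) ∣ +_) (∣preimage∣ σ X) ⟨
      ∣ ∂ (preimage σ→ X) ∣ + ∣ preimage σ→ X ∣     ≡⟨ ∣∂p∣+∣p∣≡∣N⁺p∣ Γ-refl (preimage σ→ X) ⟩
      ∣ N⁺ (preimage σ→ X) ∣                         ≡⟨ cong ∣_∣ (N⁺-preimage X) ⟩
      ∣ preimage σ→ (N⁺ X) ∣                         ≡⟨ ∣preimage∣ σ (N⁺ X) ⟩
      ∣ N⁺ X ∣                                        ≡⟨ ∣∂p∣+∣p∣≡∣N⁺p∣ Γ-refl X ⟨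
      ∣ ∂ X ∣ + ∣ X ∣                                 ∎)
      where open ≡-Reasoning

  record Anchored (u : Fin n) (X : Subset n) : Set where
    field
      anchor∈      : u ∈ X
      in-neighbour : ∀ {t} → t ∈ X → Γ t u ≡ true → t ≡ u

  open Anchored public

  anchored? : ∀ u X → Dec (Anchored u X)
  anchored? u X = Dec.map′ (λ (u∈X , only-u) → record { anchor∈ = u∈X ; in-neighbour = λ {t} → only-u t })
                           (λ A → anchor∈ A , λ t → in-neighbour A)
                           (u ∈? X ×-dec all? (λ t → t ∈? X →-dec (Γ t u ≟ᵇ true →-dec t ≟ᶠ u)))

  anchored-somewhere? : ∀ X → Dec (∃ λ u → Anchored u X)
  anchored-somewhere? X = any? (λ u → anchored? u X)

  ∩inn≡⁅⁆⇒Anchored : ∀ {u X} → X ∩ inn Γ u ≡ ⁅ u ⁆ → Anchored u X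
  ∩inn≡⁅⁆⇒Anchored {u} {X} X∩Γ⁻u≡⁅u⁆ = record
    { anchor∈      = proj₁ (x∈p∩q⁻ X (inn Γ u) (subst (u ∈_) (sym X∩Γ⁻u≡⁅u⁆) (x∈⁅x⁆ u)))
    ; in-neighbour = λ t∈X t→u → x∈⁅y⁆⇒x≡y u (subst (_ ∈_) X∩Γ⁻u≡⁅u⁆ (x∈p∩q⁺ (t∈X , ∈tabulate⁺ t→u)))
    }

  Anchored-⊆ : ∀ {u p q} → u ∈ p → p ⊆ q → Anchored u q → Anchored u p
  Anchored-⊆ u∈p p⊆q Aq = record { anchor∈ = u∈p ; in-neighbour = in-neighbour Aq ∘ p⊆q }

  Anchored-∩ : ∀ {b p q} → b ∈ p → Anchored b q → Anchored b (p ∩ q)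
  Anchored-∩ {p = p} {q} b∈p Aq = Anchored-⊆ (x∈p∩q⁺ (b∈p , anchor∈ Aq)) (p∩q⊆q p q) Aq

  Anchored-∪ : ∀ {a p q} → Anchored a p → a ∉ N⁺ q → Anchored a (p ∪ q)
  Anchored-∪ {p = p} {q} Ap a∉N⁺q = record
    { anchor∈      = x∈p∪q⁺ (inj₁ (anchor∈ Ap))
    ; in-neighbour = λ t∈p∪q t→a → [ (λ t∈p → in-neighbour Ap t∈p t→a)
                                    , (λ t∈q → contradiction (∈N⁺⁺ t∈q t→a) a∉N⁺q) ]′ (x∈p∪q⁻ p q t∈p∪q)
    }

  Anchored-preimage : ∀ {σ : Fin n ⤖ Fin n} → IsAutomorphism Γ σ → ∀ {u X} →
                      Anchored (Bijection.to σ u) X → Anchored u (preimage (Bijection.to σ) X)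
  Anchored-preimage {σ} σ-aut {u} {X} A = record
    { anchor∈      = ∈preimage⁺ {f = Bijection.to σ} {X} (anchor∈ A)
    ; in-neighbour = λ {t} t∈ t→u → Bijection.injective σ
        (in-neighbour A (∈preimage⁻ {f = Bijection.to σ} {X} t∈) (trans (σ-aut t u) t→u))
    }

  module Atoms (Γ-refl : Reflexive Γ)
               (μ : ℕ) (μ-min : ∀ {u X} → Anchored u X → μ ≤ ∣ ∂ X ∣)
               (s : ℕ) (s-min : ∀ {u X} → Anchored u X → ∣ ∂ X ∣ ≤ μ → s ≤ ∣ X ∣) where

    record Atom (u : Fin n) (X : Subset n) : Set where
      field
        anchored : Anchored u X
        ∣∂∣≤μ    : ∣ ∂ X ∣ ≤ μ
        ∣∣≤s     : ∣ X ∣ ≤ s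

    open Atom

    atom-∈⇒∈N⁺ : ∀ {a b A B} → Atom a A → Atom b B → b ∈ A → a ∈ N⁺ B
    atom-∈⇒∈N⁺ {a} {A = A} {B} atomA atomB b∈A with a ∈? N⁺ B
    ... | yes a∈N⁺B = a∈N⁺B
    ... | no  a∉N⁺B = p⊆N⁺p Γ-refl (A⊆B (anchor∈ (anchored atomA)))
      where
      ∣∂A∩B∣≤μ : ∣ ∂ (A ∩ B) ∣ ≤ μ
      ∣∂A∩B∣≤μ = +-cancelʳ-≤ μ _ _ (begin
        ∣ ∂ (A ∩ B) ∣ + μ             ≤⟨ +-monoʳ-≤ ∣ ∂ (A ∩ B) ∣ (μ-min (Anchored-∪ (anchored atomA) a∉N⁺B)) ⟩
        ∣ ∂ (A ∩ B) ∣ + ∣ ∂ (A ∪ B) ∣ ≤⟨ ∂-submodular Γ-refl A B ⟩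
        ∣ ∂ A ∣ + ∣ ∂ B ∣             ≤⟨ +-mono-≤ (∣∂∣≤μ atomA) (∣∂∣≤μ atomB) ⟩
        μ + μ                          ∎)
        where open ≤-Reasoning
      B⊆A∩B : B ⊆ A ∩ B
      B⊆A∩B = p⊆q⇒∣q∣≤∣p∣⇒q⊆p (p∩q⊆q A B)
                (≤-trans (∣∣≤s atomB) (s-min (Anchored-∩ b∈A (anchored atomB)) ∣∂A∩B∣≤μ))
      A⊆B : A ⊆ B
      A⊆B = p⊆q⇒∣q∣≤∣p∣⇒q⊆p (λ x∈B → proj₁ (x∈p∩q⁻ A B (B⊆A∩B x∈B)))
              (≤-trans (∣∣≤s atomA) (s-min (anchored atomB) (∣∂∣≤μ atomB)))

    Atom-preimage : ∀ {σ : Fin n ⤖ Fin n} → IsAutomorphism Γ σ → ∀ {u X} →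
                    Atom (Bijection.to σ u) X → Atom u (preimage (Bijection.to σ) X)
    Atom-preimage {σ} σ-aut {X = X} atom = record
      { anchored = Anchored-preimage {σ} σ-aut (anchored atom)
      ; ∣∂∣≤μ    = subst (_≤ μ) (sym (∣∂preimage∣ {σ} σ-aut Γ-refl X)) (∣∂∣≤μ atom)
      ; ∣∣≤s     = subst (_≤ s) (sym (∣preimage∣ σ X)) (∣∣≤s atom)
      }

    atom-everywhere : PointTransitive Γ → ∀ {u A} → Atom u A → ∀ a → ∃ (Atom a)
    atom-everywhere pt {u} atom a with pt a u
    ... | σ , σ-aut , refl = _ , Atom-preimage {σ} σ-aut atom

    -- A non-loop arc a → b is charged to b ∈ ∂(Y a) if b ∉ Y a (an exit), and otherwise, by
    -- atom-∈⇒∈N⁺, to a ∈ ∂(Y b) (an entry of b); no incidence is charged twice.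
    module Charging (Y : Fin n → Subset n) (atom : ∀ a → Atom a (Y a)) where

      Exit Inner : Fin n → Fin n → Set
      Exit  a b = Γ a b ≡ true × b ∉ Y a
      Inner a b = Γ a b ≡ true × b ≢ a × b ∈ Y a

      exit? : ∀ a b → Dec (Exit a b)
      exit? a b = Γ a b ≟ᵇ true ×-dec ¬? (b ∈? Y a)

      inner? : ∀ a b → Dec (Inner a b)
      inner? a b = Γ a b ≟ᵇ true ×-dec ¬? (b ≟ᶠ a) ×-dec b ∈? Y a

      exit inner : Fin n → Fin n → ℕ
      exit  a b = 𝟙 (exit? a b)
      inner a b = 𝟙 (inner? a b)

      exits inners entries : Fin n → ℕ
      exits   a = ∑[ b < n ] exit a b
      inners  a = ∑[ b < n ] inner a b
      entries a = ∑[ b < n ] inner b a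

      out-degree : ∀ {r} → Regular Γ r → ∀ a → r ≤ 1 + (exits a + inners a)
      out-degree {r} reg a = begin
        r                                                    ≡⟨ reg a ⟨
        ∣ out Γ a ∣                                           ≡⟨ ∣p∣≡∑𝟙∈ (out Γ a) ⟩
        ∑[ b < n ] 𝟙 (b ∈? out Γ a)                           ≤⟨ ∑-mono-≤ arc-count ⟩
        ∑[ b < n ] (𝟙 (b ∈? ⁅ a ⁆) + (exit a b + inner a b)) ≡⟨ ∑-distrib-+ (λ b → 𝟙 (b ∈? ⁅ a ⁆)) _ ⟩
        ∑[ b < n ] 𝟙 (b ∈? ⁅ a ⁆) + ∑[ b < n ] (exit a b + inner a b)
          ≡⟨ cong₂ _+_ (trans (sym (∣p∣≡∑𝟙∈ ⁅ a ⁆)) (∣⁅x⁆∣≡1 a)) (∑-distrib-+ (exit a) (inner a)) ⟩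
        1 + (exits a + inners a)                             ∎
        where
        open ≤-Reasoning
        arc-split : ∀ {b} → b ∈ out Γ a → b ∈ ⁅ a ⁆ ⊎ (Exit a b ⊎ Inner a b)
        arc-split {b} b∈Γa with b ≟ᶠ a | b ∈? Y a
        ... | yes refl | _       = inj₁ (x∈⁅x⁆ a)
        ... | no  b≢a  | no b∉Y  = inj₂ (inj₁ (∈tabulate⁻ b∈Γa , b∉Y))
        ... | no  b≢a  | yes b∈Y = inj₂ (inj₂ (∈tabulate⁻ b∈Γa , b≢a , b∈Y))
        arc-count : ∀ b → 𝟙 (b ∈? out Γ a) ≤ 𝟙 (b ∈? ⁅ a ⁆) + (exit a b + inner a b)
        arc-count b = ≤-trans (𝟙-cover arc-split (b ∈? out Γ a) (b ∈? ⁅ a ⁆) (exit? a b ⊎-dec inner? a b))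
                              (+-monoʳ-≤ _ (𝟙-cover id (exit? a b ⊎-dec inner? a b) (exit? a b) (inner? a b)))

      boundary : ∀ a → exits a + entries a ≤ μ
      boundary a = begin
        exits a + entries a                ≡⟨ ∑-distrib-+ (exit a) (λ b → inner b a) ⟨
        ∑[ b < n ] (exit a b + inner b a)  ≤⟨ ∑-mono-≤ incidence ⟩
        ∑[ b < n ] 𝟙 (b ∈? ∂ (Y a))        ≡⟨ ∣p∣≡∑𝟙∈ (∂ (Y a)) ⟨
        ∣ ∂ (Y a) ∣                        ≤⟨ ∣∂∣≤μ (atom a) ⟩
        μ                                  ∎
        where
        open ≤-Reasoning
        exit⇒∂ : ∀ {b} → Exit a b → b ∈ ∂ (Y a)
        exit⇒∂ (a→b , b∉Ya) = x∈p∧x∉q⇒x∈p─q (∈N⁺⁺ (anchor∈ (anchored (atom a))) a→b) b∉Ya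
        inner⇒∂ : ∀ {b} → Inner b a → b ∈ ∂ (Y a)
        inner⇒∂ {b} (b→a , a≢b , a∈Yb) = x∈p∧x∉q⇒x∈p─q (atom-∈⇒∈N⁺ (atom b) (atom a) a∈Yb)
                                           (λ b∈Ya → a≢b (sym (in-neighbour (anchored (atom a)) b∈Ya b→a)))
        exit⇒¬inner : ∀ {b} → Exit a b → ¬ Inner b a
        exit⇒¬inner {b} (a→b , _) (_ , a≢b , a∈Yb) = a≢b (in-neighbour (anchored (atom b)) a∈Yb a→b)
        incidence : ∀ b → exit a b + inner b a ≤ 𝟙 (b ∈? ∂ (Y a))
        incidence b = 𝟙-disjoint exit⇒∂ inner⇒∂ exit⇒¬inner (exit? a b) (inner? b a) (b ∈? ∂ (Y a))

    r∸1≤μ : ∀ {r} → Regular Γ r → PointTransitive Γ → ∀ {u A} → Atom u A → r ∸ 1 ≤ μ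
    r∸1≤μ {r} reg pt {u} atomA = ∸-monoˡ-≤ 1 (*-cancelˡ-≤ n {{nonZeroIndex u}} (begin
      n * r                                               ≡⟨ ∑-const n r ⟨
      ∑[ a < n ] r                                        ≤⟨ ∑-mono-≤ (out-degree reg) ⟩
      ∑[ a < n ] (1 + (exits a + inners a))               ≡⟨ ∑-distrib-+ (λ _ → 1) (λ a → exits a + inners a) ⟩
      ∑[ a < n ] 1 + ∑[ a < n ] (exits a + inners a)      ≡⟨ cong₂ _+_ (∑-const n 1) (∑-distrib-+ exits inners) ⟩
      n * 1 + (∑[ a < n ] exits a + ∑[ a < n ] inners a)  ≡⟨ cong (λ t → n * 1 + (∑[ a < n ] exits a + t)) (∑-comm inner) ⟩
      n * 1 + (∑[ a < n ] exits a + ∑[ a < n ] entries a) ≡⟨ cong (n * 1 +_) (∑-distrib-+ exits entries) ⟨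
      n * 1 + ∑[ a < n ] (exits a + entries a)            ≤⟨ +-monoʳ-≤ (n * 1) (∑-mono-≤ boundary) ⟩
      n * 1 + ∑[ a < n ] μ                                ≡⟨ cong₂ _+_ (*-identityʳ n) (∑-const n μ) ⟩
      n + n * μ                                           ≡⟨ *-suc n μ ⟨
      n * suc μ                                           ∎))
      where
      open ≤-Reasoning
      open Charging (λ a → proj₁ (atom-everywhere pt atomA a)) (λ a → proj₂ (atom-everywhere pt atomA a))

  r∸1≤∣∂∣ : ∀ {r} → Reflexive Γ → PointTransitive Γ → Regular Γ r → ∀ {u X} → Anchored u X → r ∸ 1 ≤ ∣ ∂ X ∣
  r∸1≤∣∂∣ Γ-refl pt reg {u} X-anch
    with ∃-minimal anchored-somewhere? (∣_∣ ∘ ∂) (u , X-anch)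
  ... | X₀ , X₀-anch , μ-min
    with ∃-minimal (λ Y → anchored-somewhere? Y ×-dec ∣ ∂ Y ∣ ≤? ∣ ∂ X₀ ∣) ∣_∣ (X₀-anch , ≤-refl)
  ... | A , ((_ , A-anch) , ∣∂A∣≤μ) , s-min =
    ≤-trans (r∸1≤μ reg pt (record { anchored = A-anch ; ∣∂∣≤μ = ∣∂A∣≤μ ; ∣∣≤s = ≤-refl }))
            (μ-min (u , X-anch))
    where
    open Atoms Γ-refl (∣ ∂ X₀ ∣) (λ anch → μ-min (_ , anch)) (∣ A ∣) (λ anch ∣∂∣≤μ → s-min ((_ , anch) , ∣∂∣≤μ))

  power-mono : Reflexive Γ → ∀ {v k m} → k ≤ m → power Γ k v ⊆ power Γ m v
  power-mono Γ-refl {v} k≤m = go (≤⇒≤′ k≤m)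
    where
    go : ∀ {k m} → k ≤′ m → power Γ k v ⊆ power Γ m v
    go ≤′-refl        = id
    go (≤′-step k≤m) = p⊆N⁺p Γ-refl ∘ go k≤m

  power-anchored : Reflexive Γ → ∀ {v j} → power Γ j v ∩ inn Γ v ≡ ⁅ v ⁆ →
                   ∀ {k} → k ≤ j → Anchored v (power Γ k v)
  power-anchored Γ-refl {v} Γʲv∩Γ⁻v≡⁅v⁆ {k} k≤j =
    Anchored-⊆ (power-mono Γ-refl {m = k} z≤n (x∈⁅x⁆ v)) (power-mono Γ-refl k≤j) (∩inn≡⁅⁆⇒Anchored Γʲv∩Γ⁻v≡⁅v⁆)

  power-growth : ∀ {r} → Reflexive Γ → PointTransitive Γ → Regular Γ r → ∀ {v} j →
                 (∀ {k} → k < j → Anchored v (power Γ k v)) → 1 + (r ∸ 1) * j ≤ ∣ power Γ j v ∣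
  power-growth {r} _ _ _ {v} zero _ = ≤-reflexive (trans (cong suc (*-zeroʳ (r ∸ 1))) (sym (∣⁅x⁆∣≡1 v)))
  power-growth {r} Γ-refl pt reg {v} (suc j) anchored = begin
    1 + (r ∸ 1) * suc j                  ≡⟨ cong suc (*-suc (r ∸ 1) j) ⟩
    1 + ((r ∸ 1) + (r ∸ 1) * j)          ≡⟨ +-suc (r ∸ 1) ((r ∸ 1) * j) ⟨
    (r ∸ 1) + (1 + (r ∸ 1) * j)          ≤⟨ +-mono-≤ (r∸1≤∣∂∣ Γ-refl pt reg (anchored ≤-refl))
                                                     (power-growth Γ-refl pt reg j (λ k<j → anchored (m<n⇒m<1+n k<j))) ⟩
    ∣ ∂ (power Γ j v) ∣ + ∣ power Γ j v ∣ ≡⟨ ∣∂p∣+∣p∣≡∣N⁺p∣ Γ-refl (power Γ j v) ⟩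
    ∣ power Γ (suc j) v ∣                 ∎
    where open ≤-Reasoning

corollary4p3 : (n : ℕ) (Γ : Relation n) (r : ℕ) → Reflexive Γ → PointTransitive Γ
    → Regular Γ r → (v : Fin n) (j : ℕ) → j ≥ 1
    → (power Γ j v ∩ inn Γ v) ≡ ⁅ v ⁆
    → ∣ power Γ j v ∣ ≥ 1 + (r ∸ 1) * j
corollary4p3 n Γ r Γ-refl pt reg v j _ Γʲv∩Γ⁻v≡⁅v⁆ =
  power-growth Γ Γ-refl pt reg j (λ k<j → power-anchored Γ Γ-refl Γʲv∩Γ⁻v≡⁅v⁆ (<⇒≤ k<j))
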